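{- Let $M,s\to\infty$ and let $A,B$ be integers with $A,B\ge s\sqrt M$ (and $M+B-A\ge0$). Place $M+B-A$ balls independently and uniformly at random into bins $1,\dots,M$, let $Z_i$ be the number of balls in bin $i$, and define $Y_0=A$, $Y_i=Y_{i-1}+Z_i-1$ for $1\le i\le M$ (so $Y_M=B$). Let $\mathrm{MIN}=\min_{0\le i\le M}Y_i$. Then $\Pr[\mathrm{MIN}\le0]=o(1)$. -}

module Defs where

open import Data.Nat using (ℕ; zero; suc; _≟_)
open import Data.Fin using (Fin; toℕ)
open import Data.Vec using (Vec; []; _∷_)
open import Data.List using (List; [_]; concatMap; map; allFin; upTo; filter; length)
open import Data.List.Relation.Unary.Any using (Any; any?)
open import Data.Integer using (ℤ; +_; _-_; _≤?_) renaming (_+_ to _+ℤ_; _≤_ to _≤ℤ_)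
import Data.Integer as ℤ
open import Relation.Nullary using (Dec; yes; no)

-- An outcome of throwing N balls into bins: v j = bin of ball j.
-- Bin i (1 ≤ i ≤ M) is represented by the Fin index i - 1.
Outcome : ℕ → ℕ → Set
Outcome M N = Vec (Fin M) N

-- All M^N outcomes (each equally likely under independent uniform placement).
allOutcomes : (M N : ℕ) → List (Outcome M N)
allOutcomes M zero = [ [] ]
allOutcomes M (suc N) = concatMap (λ i → map (i ∷_) (allOutcomes M N)) (allFin M)

Z : ∀ {M N} → Outcome M N → ℕ → ℕ
Z [] i = 0
Z (b ∷ v) i with suc (toℕ b) ≟ i
... | yes _ = suc (Z v i)
... | no _ = Z v i

Y : ∀ {M N} → ℕ → Outcome M N → ℕ → ℤ
Y A v zero = + A
Y A v (suc i) = Y A v i +ℤ + Z v (suc i) - + 1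

MIN≤0 : ∀ {M N} → ℕ → Outcome M N → Set
MIN≤0 {M} A v = Any (λ i → Y A v i ≤ℤ + 0) (upTo (suc M))

MIN≤0? : ∀ {M N} (A : ℕ) (v : Outcome M N) → Dec (MIN≤0 A v)
MIN≤0? {M} A v = any? (λ i → Y A v i ≤? + 0) (upTo (suc M))

-- Number of outcomes with MIN ≤ 0; Pr[MIN ≤ 0] = badCount M A N / M^N.
badCount : (M A N : ℕ) → ℕ
badCount M A N = length (filter (MIN≤0? A) (allOutcomes M N))

-- Process the bins one at a time and write (n)ⱼ = n P′ j.  With m bins and n balls left, the
-- number of balls outside the next bin is Binomial(n, (m - 1)/m), whose j-th factorial moment is
-- (n)ⱼ ((m - 1)/m)ʲ, so (n)ⱼ / mʲ is a martingale.  When the walk first reaches 0 with m bins left,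
-- the remaining balls must lift it to B, so n = m + B and (n)ⱼ / mʲ ≥ (M + B)ⱼ / Mʲ.  Optional
-- stopping gives Pr[MIN ≤ 0] ≤ (N)ⱼ / (M + B)ⱼ ≤ Mʲ / (M + B)ⱼ for N = M + B - A ≤ M, and with
-- j = ⌊B/2⌋ Bernoulli's inequality turns B² ≥ 4(k + 1)² M into (M + B)ⱼ ≥ (k + 1) Mʲ.
-- If B > A, the extra balls only raise the walk, which reduces to the case B = A.

{-# OPTIONS --safe #-}
module Submission where

open import Data.Empty using (⊥-elim)
open import Data.Fin using (Fin; zero; suc; toℕ)
open import Data.Integer using (ℤ; _-_; +≤+) renaming (+_ to ⁺_; _+_ to _+ℤ_; _≤_ to _≤ℤ_)
open import Data.List using (List; []; _∷_; _++_; map; concatMap; allFin; tabulate; filter; length)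
open import Data.List.Properties using (map-tabulate; length-tabulate; filter-accept; filter-reject)
open import Data.List.Relation.Unary.Any.Properties using (applyUpTo⁺; applyUpTo⁻)
open import Data.Nat
  using (ℕ; zero; suc; _+_; _*_; _∸_; _^_; _≤_; _<_; z≤n; s≤s; _≟_; _≤?_; ⌊_/2⌋; ⌈_/2⌉;
         NonZero; >-nonZero; >-nonZero⁻¹)
open import Data.Nat.Combinatorics.Base using (_P′_)
open import Data.Nat.Properties
open import Algebra.Properties.CommutativeSemigroup *-commutativeSemigroup using (x∙yz≈y∙xz)
open import Data.Nat.Tactic.RingSolver using (solve-∀)
open import Data.Product using (∃; ∃₂; _×_; _,_)
open import Data.Vec as Vec using (toList)
open import Data.Vec.Properties using (length-toList)
open import Function using (_∘_; id)
open import Relation.Binary.PropositionalEquality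
open import Relation.Nullary using (¬_; yes; no)

open import Defs

private variable
  A B : Set
  m n : ℕ

-- Sums over outcomes

∑ : List A → (A → ℕ) → ℕ
∑ []       f = 0
∑ (x ∷ xs) f = f x + ∑ xs f

syntax ∑ xs (λ x → e) = ∑[ x ∈ xs ] e

∑-cong : ∀ (xs : List A) {f g : A → ℕ} → (∀ x → f x ≡ g x) → ∑ xs f ≡ ∑ xs g
∑-cong []       f≡g = refl
∑-cong (x ∷ xs) f≡g = cong₂ _+_ (f≡g x) (∑-cong xs f≡g)

∑-mono : ∀ (xs : List A) {f g : A → ℕ} → (∀ x → f x ≤ g x) → ∑ xs f ≤ ∑ xs g
∑-mono []       f≤g = z≤n
∑-mono (x ∷ xs) f≤g = +-mono-≤ (f≤g x) (∑-mono xs f≤g)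

∑-++ : ∀ (xs ys : List A) f → ∑ (xs ++ ys) f ≡ ∑ xs f + ∑ ys f
∑-++ []       ys f = refl
∑-++ (x ∷ xs) ys f = trans (cong (f x +_) (∑-++ xs ys f)) (sym (+-assoc (f x) _ _))

∑-map : ∀ (g : A → B) xs f → ∑ (map g xs) f ≡ ∑ xs (f ∘ g)
∑-map g []       f = refl
∑-map g (x ∷ xs) f = cong (f (g x) +_) (∑-map g xs f)

∑-concatMap : ∀ (h : A → List B) xs f → ∑ (concatMap h xs) f ≡ ∑[ x ∈ xs ] ∑ (h x) f
∑-concatMap h []       f = refl
∑-concatMap h (x ∷ xs) f =
  trans (∑-++ (h x) (concatMap h xs) f) (cong (∑ (h x) f +_) (∑-concatMap h xs f))

∑-const : ∀ (xs : List A) c → ∑[ x ∈ xs ] c ≡ length xs * c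
∑-const []       c = refl
∑-const (x ∷ xs) c = cong (c +_) (∑-const xs c)

∑-*ˡ : ∀ c (xs : List A) f → ∑[ x ∈ xs ] (c * f x) ≡ c * ∑ xs f
∑-*ˡ c []       f = sym (*-zeroʳ c)
∑-*ˡ c (x ∷ xs) f = trans (cong (c * f x +_) (∑-*ˡ c xs f)) (sym (*-distribˡ-+ c (f x) _))

∑-+ : ∀ (xs : List A) f g → ∑[ x ∈ xs ] (f x + g x) ≡ ∑ xs f + ∑ xs g
∑-+ []       f g = refl
∑-+ (x ∷ xs) f g =
  trans (cong (f x + g x +_) (∑-+ xs f g)) (interchange (f x) (g x) (∑ xs f) (∑ xs g))
  where
  interchange : ∀ a b c d → a + b + (c + d) ≡ a + c + (b + d)
  interchange = solve-∀

∑-comm : ∀ (xs : List A) (ys : List B) (f : A → B → ℕ) →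
         ∑[ x ∈ xs ] ∑ ys (f x) ≡ ∑[ y ∈ ys ] ∑[ x ∈ xs ] f x y
∑-comm []       ys f = sym (trans (∑-const ys 0) (*-zeroʳ (length ys)))
∑-comm (x ∷ xs) ys f =
  trans (cong (∑ ys (f x) +_) (∑-comm xs ys f)) (sym (∑-+ ys (f x) (λ y → ∑[ x′ ∈ xs ] f x′ y)))

∑-allFin-suc : ∀ m (F : Fin (suc m) → ℕ) → ∑ (allFin (suc m)) F ≡ F zero + ∑[ i ∈ allFin m ] F (suc i)
∑-allFin-suc m F =
  cong (F zero +_) (trans (cong (λ is → ∑ is F) (sym (map-tabulate id suc))) (∑-map suc (allFin m) F))

∑-allFin-const : ∀ m c → ∑[ i ∈ allFin m ] c ≡ m * c
∑-allFin-const m c = trans (∑-const (allFin m) c) (cong (_* c) (length-tabulate {n = m} id))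

∑ᵒ : (m n : ℕ) → (List (Fin m) → ℕ) → ℕ
∑ᵒ m n g = ∑[ v ∈ allOutcomes m n ] g (toList v)

∑ᵒ-cong : ∀ m n {f g : List (Fin m) → ℕ} →
          (∀ l → length l ≡ n → f l ≡ g l) → ∑ᵒ m n f ≡ ∑ᵒ m n g
∑ᵒ-cong m n f≡g = ∑-cong (allOutcomes m n) (λ v → f≡g (toList v) (length-toList v))

∑ᵒ-mono : ∀ m n {f g : List (Fin m) → ℕ} →
          (∀ l → length l ≡ n → f l ≤ g l) → ∑ᵒ m n f ≤ ∑ᵒ m n g
∑ᵒ-mono m n f≤g = ∑-mono (allOutcomes m n) (λ v → f≤g (toList v) (length-toList v))

∑ᵒ-*ˡ : ∀ m n c (f : List (Fin m) → ℕ) → ∑ᵒ m n (λ l → c * f l) ≡ c * ∑ᵒ m n f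
∑ᵒ-*ˡ m n c f = ∑-*ˡ c (allOutcomes m n) (f ∘ toList)

∑ᵒ-+ : ∀ m n (f g : List (Fin m) → ℕ) → ∑ᵒ m n (λ l → f l + g l) ≡ ∑ᵒ m n f + ∑ᵒ m n g
∑ᵒ-+ m n f g = ∑-+ (allOutcomes m n) (f ∘ toList) (g ∘ toList)

∑ᵒ-suc : ∀ m n g → ∑ᵒ m (suc n) g ≡ ∑[ i ∈ allFin m ] ∑ᵒ m n (λ l → g (i ∷ l))
∑ᵒ-suc m n g = trans (∑-concatMap (λ i → map (i Vec.∷_) (allOutcomes m n)) (allFin m) (g ∘ toList))
                     (∑-cong (allFin m) (λ i → ∑-map (i Vec.∷_) (allOutcomes m n) (g ∘ toList)))

∑ᵒ-suc-split : ∀ m n g → ∑ᵒ (suc m) (suc n) g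
             ≡ ∑ᵒ (suc m) n (λ l → g (zero ∷ l)) + ∑[ b ∈ allFin m ] ∑ᵒ (suc m) n (λ l → g (suc b ∷ l))
∑ᵒ-suc-split m n g = trans (∑ᵒ-suc (suc m) n g) (∑-allFin-suc m _)

∑ᵒ-const : ∀ m n c → ∑ᵒ m n (λ _ → c) ≡ m ^ n * c
∑ᵒ-const m zero    c = cong (c +_) (sym (+-identityʳ 0))
∑ᵒ-const m (suc n) c = begin
  ∑ᵒ m (suc n) (λ _ → c)               ≡⟨ ∑ᵒ-suc m n _ ⟩
  ∑[ i ∈ allFin m ] ∑ᵒ m n (λ _ → c)   ≡⟨ ∑-cong (allFin m) (λ _ → ∑ᵒ-const m n c) ⟩
  ∑[ i ∈ allFin m ] (m ^ n * c)        ≡⟨ ∑-allFin-const m _ ⟩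
  m * (m ^ n * c)                      ≡⟨ *-assoc m _ c ⟨
  m ^ suc n * c                        ∎
  where open ≡-Reasoning

firstCount : List (Fin (suc m)) → ℕ
firstCount []          = 0
firstCount (zero  ∷ l) = suc (firstCount l)
firstCount (suc _ ∷ l) = firstCount l

rest : List (Fin (suc m)) → List (Fin m)
rest []          = []
rest (zero  ∷ l) = rest l
rest (suc b ∷ l) = b ∷ rest l

firstCount+length-rest : ∀ (l : List (Fin (suc m))) → firstCount l + length (rest l) ≡ length l
firstCount+length-rest []          = refl
firstCount+length-rest (zero  ∷ l) = cong suc (firstCount+length-rest l)
firstCount+length-rest (suc b ∷ l) = trans (+-suc _ _) (cong suc (firstCount+length-rest l))

firstCount-oneBin : ∀ (l : List (Fin 1)) → firstCount l ≡ length l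
firstCount-oneBin []         = refl
firstCount-oneBin (zero ∷ l) = cong suc (firstCount-oneBin l)

-- Given that z balls fall into the first bin, the other n - z are uniform over the other m bins.
∑ᵒ-conditionOnFirst : ∀ m n (g : ℕ → List (Fin m) → ℕ) →
  m ^ n * ∑ᵒ (suc m) n (λ l → g (firstCount l) (rest l))
  ≡ ∑ᵒ (suc m) n (λ l → m ^ firstCount l * ∑ᵒ m (length (rest l)) (g (firstCount l)))
∑ᵒ-conditionOnFirst m zero    g = sym (+-identityʳ _)
∑ᵒ-conditionOnFirst m (suc n) g = begin
  m ^ suc n * ∑ᵒ (suc m) (suc n) (λ l → g (firstCount l) (rest l))
    ≡⟨ cong (m ^ suc n *_) (∑ᵒ-suc-split m n (λ l → g (firstCount l) (rest l))) ⟩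
  m * m ^ n * (∑ᵒ (suc m) n inFirst + ∑[ b ∈ allFin m ] ∑ᵒ (suc m) n (elsewhere b))
    ≡⟨ distrib m (m ^ n) _ _ ⟩
  m * (m ^ n * ∑ᵒ (suc m) n inFirst) + m * (m ^ n * ∑[ b ∈ allFin m ] ∑ᵒ (suc m) n (elsewhere b))
    ≡⟨ cong (λ t → m * (m ^ n * ∑ᵒ (suc m) n inFirst) + m * t) (∑-*ˡ (m ^ n) (allFin m) _) ⟨
  m * (m ^ n * ∑ᵒ (suc m) n inFirst) + m * ∑[ b ∈ allFin m ] (m ^ n * ∑ᵒ (suc m) n (elsewhere b))
    ≡⟨ cong₂ (λ x y → m * x + m * y)
             (∑ᵒ-conditionOnFirst m n (g ∘ suc))
             (∑-cong (allFin m) (λ b → ∑ᵒ-conditionOnFirst m n (λ z w → g z (b ∷ w)))) ⟩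
  m * ∑ᵒ (suc m) n (conditioned (g ∘ suc))
    + m * ∑[ b ∈ allFin m ] ∑ᵒ (suc m) n (conditioned (λ z w → g z (b ∷ w)))
    ≡⟨ cong₂ _+_ ballInFirst ballElsewhere ⟩
  ∑ᵒ (suc m) n (conditioned g ∘ (zero ∷_)) + ∑[ b ∈ allFin m ] ∑ᵒ (suc m) n (conditioned g ∘ (suc b ∷_))
    ≡⟨ ∑ᵒ-suc-split m n (conditioned g) ⟨
  ∑ᵒ (suc m) (suc n) (conditioned g)
    ∎
  where
  open ≡-Reasoning
  inFirst : List (Fin (suc m)) → ℕ
  inFirst l = g (suc (firstCount l)) (rest l)
  elsewhere : Fin m → List (Fin (suc m)) → ℕ
  elsewhere b l = g (firstCount l) (b ∷ rest l)
  conditioned : (ℕ → List (Fin m) → ℕ) → List (Fin (suc m)) → ℕ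
  conditioned h l = m ^ firstCount l * ∑ᵒ m (length (rest l)) (h (firstCount l))
  distrib : ∀ m p x y → m * p * (x + y) ≡ m * (p * x) + m * (p * y)
  distrib = solve-∀
  ballInFirst : m * ∑ᵒ (suc m) n (conditioned (g ∘ suc)) ≡ ∑ᵒ (suc m) n (conditioned g ∘ (zero ∷_))
  ballInFirst = trans (sym (∑ᵒ-*ˡ (suc m) n m (conditioned (g ∘ suc))))
                      (∑ᵒ-cong (suc m) n (λ l _ →
                        sym (*-assoc m (m ^ firstCount l) (∑ᵒ m (length (rest l)) (g (suc (firstCount l)))))))
  ballElsewhere : m * ∑[ b ∈ allFin m ] ∑ᵒ (suc m) n (conditioned (λ z w → g z (b ∷ w)))
                ≡ ∑[ b ∈ allFin m ] ∑ᵒ (suc m) n (conditioned g ∘ (suc b ∷_))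
  ballElsewhere = begin
    m * ∑[ b ∈ allFin m ] ∑ᵒ (suc m) n (conditioned (λ z w → g z (b ∷ w)))
      ≡⟨ cong (m *_) (∑-comm (allFin m) (allOutcomes (suc m) n) _) ⟩
    m * ∑ᵒ (suc m) n (λ l → ∑[ b ∈ allFin m ] conditioned (λ z w → g z (b ∷ w)) l)
      ≡⟨ cong (m *_) (∑ᵒ-cong (suc m) n (λ l _ →
           trans (∑-*ˡ (m ^ firstCount l) (allFin m) _)
                 (cong (m ^ firstCount l *_) (sym (∑ᵒ-suc m (length (rest l)) (g (firstCount l))))))) ⟩
    m * ∑ᵒ (suc m) n (λ l → m ^ firstCount l * ∑ᵒ m (suc (length (rest l))) (g (firstCount l)))
      ≡⟨ ∑-allFin-const m _ ⟨
    ∑[ b ∈ allFin m ] ∑ᵒ (suc m) n (conditioned g ∘ (suc b ∷_))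
      ∎

-- Falling factorials

P′-vanishes : ∀ {n k} → n ≤ k → n P′ suc k ≡ 0
P′-vanishes {n} {k} n≤k = cong (_* (n P′ k)) (m≤n⇒m∸n≡0 n≤k)

P′-absorb : ∀ r k → suc r P′ suc k ≡ suc r * (r P′ k)
P′-absorb r zero    = refl
P′-absorb r (suc k) = trans (cong ((r ∸ k) *_) (P′-absorb r k)) (x∙yz≈y∙xz (r ∸ k) (suc r) (r P′ k))

P′-pascal : ∀ r k → suc r P′ suc k ≡ r P′ suc k + suc k * (r P′ k)
P′-pascal r k with k ≤? r
... | yes k≤r = begin
  suc r P′ suc k               ≡⟨ P′-absorb r k ⟩
  suc r * (r P′ k)             ≡⟨ cong (_* (r P′ k)) (trans (+-suc (r ∸ k) k) (cong suc (m∸n+n≡m k≤r))) ⟨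
  (r ∸ k + suc k) * (r P′ k)   ≡⟨ *-distribʳ-+ (r P′ k) (r ∸ k) (suc k) ⟩
  r P′ suc k + suc k * (r P′ k) ∎
  where open ≡-Reasoning
P′-pascal r zero    | no 0≰r = ⊥-elim (0≰r z≤n)
P′-pascal r (suc k) | no k≰r = begin
  suc r P′ suc (suc k)                           ≡⟨ P′-absorb r (suc k) ⟩
  suc r * (r P′ suc k)                           ≡⟨ cong (suc r *_) vanishes ⟩
  suc r * 0                                      ≡⟨ *-zeroʳ (suc r) ⟩
  0                                              ≡⟨ cong₂ _+_ (*-zeroʳ (r ∸ suc k)) (*-zeroʳ (suc (suc k))) ⟨
  (r ∸ suc k) * 0 + suc (suc k) * 0              ≡⟨ cong (λ x → (r ∸ suc k) * x + suc (suc k) * x) vanishes ⟨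
  r P′ suc (suc k) + suc (suc k) * (r P′ suc k)  ∎
  where
  open ≡-Reasoning
  vanishes : r P′ suc k ≡ 0
  vanishes = P′-vanishes (≤-pred (≰⇒> k≰r))

-- The balls outside the first bin are Binomial(n, m/(m + 1)), with k-th factorial moment
-- (n)ₖ (m/(m + 1))ᵏ; here with denominators cleared.
factorialMoment : ∀ m n k →
  ∑ᵒ (suc m) n (λ l → length (rest l) P′ k) * suc m ^ k ≡ (n P′ k) * m ^ k * suc m ^ n
factorialMoment m zero    zero    = refl
factorialMoment m zero    (suc k) rewrite 0∸n≡0 k = refl
factorialMoment m (suc n) zero    =
  trans (cong (_* 1) (∑ᵒ-const (suc m) (suc n) 1)) (unit (suc m ^ suc n))
  where
  unit : ∀ x → x * 1 * 1 ≡ 1 * 1 * x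
  unit = solve-∀
factorialMoment m (suc n) (suc k) = begin
  ∑ᵒ (suc m) (suc n) (λ l → length (rest l) P′ suc k) * suc m ^ suc k
    ≡⟨ cong (_* suc m ^ suc k) (∑ᵒ-suc-split m n (λ l → length (rest l) P′ suc k)) ⟩
  (Xs + ∑[ b ∈ allFin m ] ∑ᵒ (suc m) n (λ l → suc (length (rest l)) P′ suc k)) * suc m ^ suc k
    ≡⟨ cong (λ t → (Xs + t) * suc m ^ suc k) (∑-allFin-const m _) ⟩
  (Xs + m * ∑ᵒ (suc m) n (λ l → suc (length (rest l)) P′ suc k)) * suc m ^ suc k
    ≡⟨ cong (λ t → (Xs + m * t) * suc m ^ suc k) pascal ⟩
  (Xs + m * (Xs + suc k * Ys)) * suc m ^ suc k
    ≡⟨ expand Xs Ys m k (suc m ^ k) ⟩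
  suc m * (Xs * suc m ^ suc k) + m * suc k * (suc m * (Ys * suc m ^ k))
    ≡⟨ cong₂ (λ x y → suc m * x + m * suc k * (suc m * y)) (factorialMoment m n (suc k)) (factorialMoment m n k) ⟩
  suc m * ((n P′ suc k) * m ^ suc k * suc m ^ n) + m * suc k * (suc m * ((n P′ k) * m ^ k * suc m ^ n))
    ≡⟨ collect (n P′ suc k) (n P′ k) m k (m ^ k) (suc m ^ n) ⟩
  (n P′ suc k + suc k * (n P′ k)) * m ^ suc k * suc m ^ suc n
    ≡⟨ cong (λ t → t * m ^ suc k * suc m ^ suc n) (P′-pascal n k) ⟨
  (suc n P′ suc k) * m ^ suc k * suc m ^ suc n
    ∎
  where
  open ≡-Reasoning
  Xs Ys : ℕ
  Xs = ∑ᵒ (suc m) n (λ l → length (rest l) P′ suc k)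
  Ys = ∑ᵒ (suc m) n (λ l → length (rest l) P′ k)
  pascal : ∑ᵒ (suc m) n (λ l → suc (length (rest l)) P′ suc k) ≡ Xs + suc k * Ys
  pascal = begin
    ∑ᵒ (suc m) n (λ l → suc (length (rest l)) P′ suc k)
      ≡⟨ ∑ᵒ-cong (suc m) n (λ l _ → P′-pascal (length (rest l)) k) ⟩
    ∑ᵒ (suc m) n (λ l → length (rest l) P′ suc k + suc k * (length (rest l) P′ k))
      ≡⟨ ∑ᵒ-+ (suc m) n (λ l → length (rest l) P′ suc k) (λ l → suc k * (length (rest l) P′ k)) ⟩
    Xs + ∑ᵒ (suc m) n (λ l → suc k * (length (rest l) P′ k))
      ≡⟨ cong (Xs +_) (∑ᵒ-*ˡ (suc m) n (suc k) (λ l → length (rest l) P′ k)) ⟩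
    Xs + suc k * Ys
      ∎
  expand : ∀ x y m k p → (x + m * (x + suc k * y)) * (suc m * p)
                       ≡ suc m * (x * (suc m * p)) + m * suc k * (suc m * (y * p))
  expand = solve-∀
  collect : ∀ a b m k p q → suc m * (a * (m * p) * q) + m * suc k * (suc m * (b * p * q))
                          ≡ (a + suc k * b) * (m * p) * (suc m * q)
  collect = solve-∀

P′≤^ : ∀ n k → n P′ k ≤ n ^ k
P′≤^ n zero    = ≤-refl
P′≤^ n (suc k) = *-mono-≤ (m∸n≤m n k) (P′≤^ n k)

[n∸k]^k≤P′ : ∀ n k → (n ∸ k) ^ k ≤ n P′ k
[n∸k]^k≤P′ n zero    = ≤-refl
[n∸k]^k≤P′ n (suc k) = *-mono-≤ n∸1+k≤n∸k (≤-trans (^-monoˡ-≤ k n∸1+k≤n∸k) ([n∸k]^k≤P′ n k))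
  where
  n∸1+k≤n∸k : n ∸ suc k ≤ n ∸ k
  n∸1+k≤n∸k = ∸-monoʳ-≤ n (n≤1+n k)

P′-ratio-antitone : ∀ {m M} b {j} → m ≤ M → j ≤ b → ((M + b) P′ j) * m ^ j ≤ M ^ j * ((m + b) P′ j)
P′-ratio-antitone b {zero}  m≤M j≤b = ≤-refl
P′-ratio-antitone {m} {M} b {suc j} m≤M 1+j≤b = begin
  (M + b ∸ j) * ((M + b) P′ j) * (m * m ^ j)          ≡⟨ regroup (M + b ∸ j) ((M + b) P′ j) m (m ^ j) ⟩
  ((M + b) P′ j) * m ^ j * ((M + b ∸ j) * m)          ≤⟨ *-mono-≤ (P′-ratio-antitone b m≤M j≤b) lastFactor ⟩
  M ^ j * ((m + b) P′ j) * (M * (m + b ∸ j))          ≡⟨ regroup′ (M ^ j) ((m + b) P′ j) M (m + b ∸ j) ⟩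
  M * M ^ j * ((m + b ∸ j) * ((m + b) P′ j))          ∎
  where
  open ≤-Reasoning
  j≤b : j ≤ b
  j≤b = ≤-trans (n≤1+n j) 1+j≤b
  regroup : ∀ a x m p → a * x * (m * p) ≡ x * p * (a * m)
  regroup = solve-∀
  regroup′ : ∀ p x M a → p * x * (M * a) ≡ M * p * (a * x)
  regroup′ = solve-∀
  lastFactor : (M + b ∸ j) * m ≤ M * (m + b ∸ j)
  lastFactor rewrite +-∸-assoc M j≤b | +-∸-assoc m j≤b = begin
    (M + (b ∸ j)) * m         ≡⟨ *-distribʳ-+ m M (b ∸ j) ⟩
    M * m + (b ∸ j) * m       ≤⟨ +-monoʳ-≤ (M * m) (*-monoʳ-≤ (b ∸ j) m≤M) ⟩
    M * m + (b ∸ j) * M       ≡⟨ cong (M * m +_) (*-comm (b ∸ j) M) ⟩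
    M * m + M * (b ∸ j)       ≡⟨ *-distribˡ-+ M m (b ∸ j) ⟨
    M * (m + (b ∸ j))         ∎

-- The walk

-- Z and Y read off the list of bins, so that the balls of the first bin can be removed.
Zˡ : List (Fin m) → ℕ → ℕ
Zˡ []      i = 0
Zˡ (b ∷ l) i with suc (toℕ b) ≟ i
... | yes _ = suc (Zˡ l i)
... | no  _ = Zˡ l i

Yˡ : ℕ → List (Fin m) → ℕ → ℤ
Yˡ A l zero    = ⁺ A
Yˡ A l (suc i) = Yˡ A l i +ℤ ⁺ Zˡ l (suc i) - ⁺ 1

Z≡Zˡ : ∀ (v : Outcome m n) i → Z v i ≡ Zˡ (toList v) i
Z≡Zˡ Vec.[]      i = refl
Z≡Zˡ (b Vec.∷ v) i with suc (toℕ b) ≟ i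
... | yes _ = cong suc (Z≡Zˡ v i)
... | no  _ = Z≡Zˡ v i

Y≡Yˡ : ∀ A (v : Outcome m n) i → Y A v i ≡ Yˡ A (toList v) i
Y≡Yˡ A v zero    = refl
Y≡Yˡ A v (suc i) = cong₂ (λ y z → y +ℤ ⁺ z - ⁺ 1) (Y≡Yˡ A v i) (Z≡Zˡ v (suc i))

Zˡ-first : ∀ (l : List (Fin (suc m))) → Zˡ l 1 ≡ firstCount l
Zˡ-first []          = refl
Zˡ-first (zero  ∷ l) = cong suc (Zˡ-first l)
Zˡ-first (suc b ∷ l) = Zˡ-first l

Zˡ-rest : ∀ (l : List (Fin (suc m))) i → Zˡ l (suc (suc i)) ≡ Zˡ (rest l) (suc i)
Zˡ-rest []          i = refl
Zˡ-rest (zero  ∷ l) i = Zˡ-rest l i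
Zˡ-rest (suc b ∷ l) i with suc (suc (toℕ b)) ≟ suc (suc i) | suc (toℕ b) ≟ suc i
... | yes _  | yes _  = cong suc (Zˡ-rest l i)
... | no  _  | no  _  = Zˡ-rest l i
... | yes eq | no  ne = ⊥-elim (ne (suc-injective eq))
... | no  ne | yes eq = ⊥-elim (ne (cong suc eq))

Yˡ-suc : ∀ y (l : List (Fin (suc m))) i → Yˡ (suc y) l (suc i) ≡ Yˡ (y + firstCount l) (rest l) i
Yˡ-suc y l zero    rewrite Zˡ-first l = refl
Yˡ-suc y l (suc i) = cong₂ (λ y z → y +ℤ ⁺ z - ⁺ 1) (Yˡ-suc y l i) (Zˡ-rest l i)

hitsZero : (m : ℕ) → ℕ → List (Fin m) → ℕ
hitsZero m       zero    l = 1
hitsZero zero    (suc y) l = 0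
hitsZero (suc m) (suc y) l = hitsZero m (y + firstCount l) (rest l)

hitsZero≤1 : ∀ m y (l : List (Fin m)) → hitsZero m y l ≤ 1
hitsZero≤1 m       zero    l = ≤-refl
hitsZero≤1 zero    (suc y) l = z≤n
hitsZero≤1 (suc m) (suc y) l = hitsZero≤1 m (y + firstCount l) (rest l)

Yˡ≤0⇒hitsZero≡1 : ∀ m y (l : List (Fin m)) i → i < suc m → Yˡ y l i ≤ℤ ⁺ 0 → hitsZero m y l ≡ 1
Yˡ≤0⇒hitsZero≡1 m       zero    l i       i≤m       Y≤0        = refl
Yˡ≤0⇒hitsZero≡1 m       (suc y) l zero    i≤m       (+≤+ ())
Yˡ≤0⇒hitsZero≡1 (suc m) (suc y) l (suc i) (s≤s i≤m) Y≤0 =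
  Yˡ≤0⇒hitsZero≡1 m (y + firstCount l) (rest l) i i≤m (subst (_≤ℤ ⁺ 0) (Yˡ-suc y l i) Y≤0)

hitsZero≡1⇒Yˡ≤0 : ∀ m y (l : List (Fin m)) → hitsZero m y l ≡ 1 → ∃ λ i → i < suc m × Yˡ y l i ≤ℤ ⁺ 0
hitsZero≡1⇒Yˡ≤0 m       zero    l _   = 0 , s≤s z≤n , +≤+ z≤n
hitsZero≡1⇒Yˡ≤0 (suc m) (suc y) l hit with hitsZero≡1⇒Yˡ≤0 m (y + firstCount l) (rest l) hit
... | i , i≤m , Y≤0 = suc i , s≤s i≤m , subst (_≤ℤ ⁺ 0) (sym (Yˡ-suc y l i)) Y≤0

MIN≤0⇒hitsZero≡1 : ∀ A (v : Outcome m n) → MIN≤0 A v → hitsZero m A (toList v) ≡ 1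
MIN≤0⇒hitsZero≡1 {m} A v MIN≤0 with applyUpTo⁻ id MIN≤0
... | i , i≤m , Y≤0 = Yˡ≤0⇒hitsZero≡1 m A (toList v) i i≤m (subst (_≤ℤ ⁺ 0) (Y≡Yˡ A v i) Y≤0)

¬MIN≤0⇒hitsZero≡0 : ∀ A (v : Outcome m n) → ¬ MIN≤0 A v → hitsZero m A (toList v) ≡ 0
¬MIN≤0⇒hitsZero≡0 {m} A v MIN>0 with hitsZero m A (toList v) in eq | hitsZero≤1 m A (toList v)
... | zero  | _       = refl
... | suc _ | s≤s z≤n with hitsZero≡1⇒Yˡ≤0 m A (toList v) eq
...   | i , i≤m , Y≤0 = ⊥-elim (MIN>0 (applyUpTo⁺ id (subst (_≤ℤ ⁺ 0) (sym (Y≡Yˡ A v i)) Y≤0) i≤m))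

ruinCount : (m y n : ℕ) → ℕ
ruinCount m y n = ∑ᵒ m n (hitsZero m y)

badCount≡ruinCount : ∀ M A N → badCount M A N ≡ ruinCount M A N
badCount≡ruinCount M A N = count (allOutcomes M N)
  where
  count : ∀ vs → length (filter (MIN≤0? A) vs) ≡ ∑[ v ∈ vs ] hitsZero M A (toList v)
  count []       = refl
  count (v ∷ vs) with MIN≤0? A v
  ... | yes p  = trans (cong length (filter-accept (MIN≤0? A) p))
                       (cong₂ _+_ (sym (MIN≤0⇒hitsZero≡1 A v p)) (count vs))
  ... | no  ¬p = trans (cong length (filter-reject (MIN≤0? A) ¬p))
                       (cong₂ _+_ (sym (¬MIN≤0⇒hitsZero≡0 A v ¬p)) (count vs))

hitsZero-antitone : ∀ m {y y′} (l : List (Fin m)) → y ≤ y′ → hitsZero m y′ l ≤ hitsZero m y l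
hitsZero-antitone m       {zero}  {y′}     l y≤y′      = hitsZero≤1 m y′ l
hitsZero-antitone zero    {suc y} {suc y′} l y≤y′      = z≤n
hitsZero-antitone (suc m) {suc y} {suc y′} l (s≤s y≤y′) =
  hitsZero-antitone m (rest l) (+-monoˡ-≤ (firstCount l) y≤y′)

hitsZero-∷ : ∀ m y b (l : List (Fin m)) → hitsZero m y (b ∷ l) ≤ hitsZero m y l
hitsZero-∷ m       zero    b       l = ≤-refl
hitsZero-∷ zero    (suc y) b       l = z≤n
hitsZero-∷ (suc m) (suc y) zero    l = hitsZero-antitone m (rest l) (+-monoʳ-≤ y (n≤1+n _))
hitsZero-∷ (suc m) (suc y) (suc b) l = hitsZero-∷ m (y + firstCount l) b (rest l)

ruinCount-suc : ∀ m y n → ruinCount m y (suc n) ≤ m * ruinCount m y n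
ruinCount-suc m y n = begin
  ruinCount m y (suc n)
    ≡⟨ ∑ᵒ-suc m n (hitsZero m y) ⟩
  ∑[ b ∈ allFin m ] ∑ᵒ m n (hitsZero m y ∘ (b ∷_))
    ≤⟨ ∑-mono (allFin m) (λ b → ∑ᵒ-mono m n (λ l _ → hitsZero-∷ m y b l)) ⟩
  ∑[ b ∈ allFin m ] ruinCount m y n
    ≡⟨ ∑-allFin-const m _ ⟩
  m * ruinCount m y n
    ∎
  where open ≤-Reasoning

ruinCount-+ : ∀ m y d n → ruinCount m y (d + n) ≤ m ^ d * ruinCount m y n
ruinCount-+ m y zero    n = ≤-reflexive (sym (+-identityʳ _))
ruinCount-+ m y (suc d) n = begin
  ruinCount m y (suc (d + n))   ≤⟨ ruinCount-suc m y (d + n) ⟩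
  m * ruinCount m y (d + n)     ≤⟨ *-monoʳ-≤ m (ruinCount-+ m y d n) ⟩
  m * (m ^ d * ruinCount m y n) ≡⟨ *-assoc m _ _ ⟨
  m ^ suc d * ruinCount m y n   ∎
  where open ≤-Reasoning

-- Optional stopping

ruinCount≡0 : ∀ m y n → (∀ l → length l ≡ n → hitsZero m y l ≡ 0) → ruinCount m y n ≡ 0
ruinCount≡0 m y n never = trans (∑ᵒ-cong m n never) (trans (∑ᵒ-const m n 0) (*-zeroʳ (m ^ n)))

noRuin : ∀ m y n {p q x} → ruinCount m y n ≡ 0 → ruinCount m y n * p * q ≤ x
noRuin m y n none rewrite none = z≤n

-- Pr[the walk reaches 0] · P/Q ≤ (n)ⱼ / mʲ, for walks over m bins that end at b.
RuinBound : (b j P Q m : ℕ) → Set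
RuinBound b j P Q m = ∀ y n → y + n ≡ m + b → ruinCount m y n * P * m ^ j ≤ m ^ n * (n P′ j) * Q

ruinBound-conditioned : ∀ {b j P Q} m .{{_ : NonZero m}} → RuinBound b j P Q m →
                        ∀ y n → suc y + n ≡ suc m + b →
                        ruinCount (suc m) (suc y) n * P * m ^ j ≤ Q * ∑ᵒ (suc m) n (λ l → length (rest l) P′ j)
ruinBound-conditioned {b} {j} {P} {Q} m bound y n end = *-cancelˡ-≤ (m ^ n) {{m^n≢0 m n}} (begin
  m ^ n * (R * P * m ^ j)                          ≡⟨ rotate (m ^ n) R P (m ^ j) ⟩
  P * m ^ j * (m ^ n * R)                          ≡⟨ cong (P * m ^ j *_) conditionOnFirst ⟩
  P * m ^ j * ∑ᵒ (suc m) n conditioned             ≡⟨ ∑ᵒ-*ˡ (suc m) n (P * m ^ j) conditioned ⟨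
  ∑ᵒ (suc m) n (λ l → P * m ^ j * conditioned l)   ≤⟨ ∑ᵒ-mono (suc m) n perOutcome ⟩
  ∑ᵒ (suc m) n (λ l → m ^ n * (Q * moment l))      ≡⟨ ∑ᵒ-*ˡ (suc m) n (m ^ n) (λ l → Q * moment l) ⟩
  m ^ n * ∑ᵒ (suc m) n (λ l → Q * moment l)        ≡⟨ cong (m ^ n *_) (∑ᵒ-*ˡ (suc m) n Q moment) ⟩
  m ^ n * (Q * ∑ᵒ (suc m) n moment)                ∎)
  where
  open ≤-Reasoning
  R : ℕ
  R = ruinCount (suc m) (suc y) n
  conditioned moment : List (Fin (suc m)) → ℕ
  conditioned l = m ^ firstCount l * ruinCount m (y + firstCount l) (length (rest l))
  moment l = length (rest l) P′ j
  conditionOnFirst : m ^ n * R ≡ ∑ᵒ (suc m) n conditioned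
  conditionOnFirst = ∑ᵒ-conditionOnFirst m n (λ z → hitsZero m (y + z))
  rotate : ∀ a x p q → a * (x * p * q) ≡ p * q * (a * x)
  rotate = solve-∀
  perOutcome : ∀ l → length l ≡ n → P * m ^ j * conditioned l ≤ m ^ n * (Q * moment l)
  perOutcome l len = begin
    P * m ^ j * (m ^ f * ruinCount m (y + f) r)   ≡⟨ regroup (P * m ^ j) (m ^ f) _ ⟩
    m ^ f * (ruinCount m (y + f) r * (P * m ^ j)) ≡⟨ cong (m ^ f *_) (*-assoc (ruinCount m (y + f) r) P (m ^ j)) ⟨
    m ^ f * (ruinCount m (y + f) r * P * m ^ j)   ≤⟨ *-monoʳ-≤ (m ^ f) (bound (y + f) r end′) ⟩
    m ^ f * (m ^ r * (r P′ j) * Q)                ≡⟨ regroup′ (m ^ f) (m ^ r) (r P′ j) Q ⟩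
    m ^ f * m ^ r * (Q * (r P′ j))                ≡⟨ cong (_* (Q * (r P′ j))) (^-distribˡ-+-* m f r) ⟨
    m ^ (f + r) * (Q * (r P′ j))                  ≡⟨ cong (λ e → m ^ e * (Q * (r P′ j))) f+r≡n ⟩
    m ^ n * (Q * (r P′ j))                        ∎
    where
    f r : ℕ
    f = firstCount l
    r = length (rest l)
    f+r≡n : f + r ≡ n
    f+r≡n = trans (firstCount+length-rest l) len
    end′ : y + f + r ≡ m + b
    end′ = trans (+-assoc y f r) (trans (cong (y +_) f+r≡n) (suc-injective end))
    regroup : ∀ x a c → x * (a * c) ≡ a * (c * x)
    regroup = solve-∀
    regroup′ : ∀ a c x q → a * (c * x * q) ≡ a * c * (q * x)
    regroup′ = solve-∀

ruinBound-step : ∀ {b j P Q} m .{{_ : NonZero m}} → RuinBound b j P Q m →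
                 ∀ y n → suc y + n ≡ suc m + b →
                 ruinCount (suc m) (suc y) n * P * suc m ^ j ≤ suc m ^ n * (n P′ j) * Q
ruinBound-step {b} {j} {P} {Q} m bound y n end = *-cancelˡ-≤ (m ^ j) {{m^n≢0 m j}} (begin
  m ^ j * (R * P * suc m ^ j)               ≡⟨ regroup (m ^ j) (R * P) (suc m ^ j) ⟩
  R * P * m ^ j * suc m ^ j                 ≤⟨ *-monoˡ-≤ (suc m ^ j) conditioned ⟩
  Q * S * suc m ^ j                         ≡⟨ *-assoc Q S (suc m ^ j) ⟩
  Q * (S * suc m ^ j)                       ≡⟨ cong (Q *_) (factorialMoment m n j) ⟩
  Q * ((n P′ j) * m ^ j * suc m ^ n)        ≡⟨ regroup′ Q (n P′ j) (m ^ j) (suc m ^ n) ⟩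
  m ^ j * (suc m ^ n * (n P′ j) * Q)        ∎)
  where
  open ≤-Reasoning
  R S : ℕ
  R = ruinCount (suc m) (suc y) n
  S = ∑ᵒ (suc m) n (λ l → length (rest l) P′ j)
  conditioned : R * P * m ^ j ≤ Q * S
  conditioned = ruinBound-conditioned {j = j} {P} {Q} m bound y n end
  regroup : ∀ a x c → a * (x * c) ≡ x * a * c
  regroup = solve-∀
  regroup′ : ∀ q x p c → q * (x * p * c) ≡ p * (c * x * q)
  regroup′ = solve-∀

ruinBound : ∀ {M b j} → 0 < b → j ≤ b → ∀ m → m ≤ M → RuinBound b j ((M + b) P′ j) (M ^ j) m
ruinBound {M} {b} {j} 0<b j≤b m m≤M zero n end = begin
  ruinCount m 0 n * P * m ^ j           ≡⟨ cong (λ c → c * P * m ^ j) (∑ᵒ-const m n 1) ⟩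
  m ^ n * 1 * P * m ^ j                 ≡⟨ regroup (m ^ n) P (m ^ j) ⟩
  m ^ n * (P * m ^ j)                   ≤⟨ *-monoʳ-≤ (m ^ n) (P′-ratio-antitone b m≤M j≤b) ⟩
  m ^ n * (M ^ j * ((m + b) P′ j))      ≡⟨ cong (λ c → m ^ n * (M ^ j * (c P′ j))) end ⟨
  m ^ n * (M ^ j * (n P′ j))            ≡⟨ regroup′ (m ^ n) (M ^ j) (n P′ j) ⟩
  m ^ n * (n P′ j) * M ^ j              ∎
  where
  open ≤-Reasoning
  P : ℕ
  P = (M + b) P′ j
  regroup : ∀ a p q → a * 1 * p * q ≡ a * (p * q)
  regroup = solve-∀
  regroup′ : ∀ a q x → a * (q * x) ≡ a * x * q
  regroup′ = solve-∀
ruinBound 0<b j≤b zero m≤M (suc y) n end =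
  noRuin 0 (suc y) n (ruinCount≡0 0 (suc y) n (λ _ _ → refl))
ruinBound {b = suc b} 0<b j≤b (suc zero) m≤M (suc y) n end =
  noRuin 1 (suc y) n (ruinCount≡0 1 (suc y) n walkEndsPositive)
  where
  walkEndsPositive : ∀ l → length l ≡ n → hitsZero 1 (suc y) l ≡ 0
  walkEndsPositive l len
    rewrite firstCount-oneBin l | len | suc-injective end = refl
ruinBound {j = j} 0<b j≤b (suc (suc m)) m≤M (suc y) n end =
  ruinBound-step {j = j} (suc m) (ruinBound 0<b j≤b (suc m) (≤-trans (n≤1+n (suc m)) m≤M)) y n end

-- The choice j = ⌊b/2⌋

n*n≤4*⌊n/2⌋*⌈n/2⌉+1 : ∀ n → n * n ≤ 4 * (⌊ n /2⌋ * ⌈ n /2⌉) + 1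
n*n≤4*⌊n/2⌋*⌈n/2⌉+1 zero          = z≤n
n*n≤4*⌊n/2⌋*⌈n/2⌉+1 (suc zero)    = ≤-refl
n*n≤4*⌊n/2⌋*⌈n/2⌉+1 (suc (suc n)) = begin
  suc (suc n) * suc (suc n)                 ≡⟨ expand n ⟩
  n * n + 4 * n + 4                         ≤⟨ +-monoˡ-≤ 4 (+-monoˡ-≤ (4 * n) (n*n≤4*⌊n/2⌋*⌈n/2⌉+1 n)) ⟩
  4 * (j * c) + 1 + 4 * n + 4               ≡⟨ cong (λ t → 4 * (j * c) + 1 + 4 * t + 4) (⌊n/2⌋+⌈n/2⌉≡n n) ⟨
  4 * (j * c) + 1 + 4 * (j + c) + 4         ≡⟨ collect j c ⟩
  4 * (suc j * suc c) + 1                   ∎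
  where
  open ≤-Reasoning
  j c : ℕ
  j = ⌊ n /2⌋
  c = ⌈ n /2⌉
  expand : ∀ n → suc (suc n) * suc (suc n) ≡ n * n + 4 * n + 4
  expand = solve-∀
  collect : ∀ j c → 4 * (j * c) + 1 + 4 * (j + c) + 4 ≡ 4 * (suc j * suc c) + 1
  collect = solve-∀

k*M≤⌊b/2⌋*⌈b/2⌉ : ∀ k M b .{{_ : NonZero M}} → 2 * suc k * (2 * suc k) * M ≤ b * b →
                  k * M ≤ ⌊ b /2⌋ * ⌈ b /2⌉
k*M≤⌊b/2⌋*⌈b/2⌉ k M b s²M≤b² = *-cancelˡ-≤ 4 (+-cancelʳ-≤ 1 _ _ (begin
  4 * (k * M) + 1                   ≤⟨ +-monoʳ-≤ (4 * (k * M)) (≤-trans (>-nonZero⁻¹ M) (m≤n*m M 4)) ⟩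
  4 * (k * M) + 4 * M               ≡⟨ *-distribˡ-+ 4 (k * M) M ⟨
  4 * (k * M + M)                   ≡⟨ cong (4 *_) (+-comm (k * M) M) ⟩
  4 * (suc k * M)                   ≤⟨ *-monoʳ-≤ 4 (m≤n*m (suc k * M) (suc k)) ⟩
  4 * (suc k * (suc k * M))         ≡⟨ square k M ⟩
  2 * suc k * (2 * suc k) * M       ≤⟨ s²M≤b² ⟩
  b * b                             ≤⟨ n*n≤4*⌊n/2⌋*⌈n/2⌉+1 b ⟩
  4 * (⌊ b /2⌋ * ⌈ b /2⌉) + 1       ∎))
  where
  open ≤-Reasoning
  square : ∀ k M → 4 * (suc k * (suc k * M)) ≡ 2 * suc k * (2 * suc k) * M
  square = solve-∀

bernoulli : ∀ M c k → M ^ k * (M + k * c) ≤ M * (M + c) ^ k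
bernoulli M c zero    = ≤-reflexive (base M c)
  where
  base : ∀ M c → 1 * (M + 0 * c) ≡ M * 1
  base = solve-∀
bernoulli M c (suc k) = begin
  M * M ^ k * (M + suc k * c)               ≡⟨ regroup M (M ^ k) c k ⟩
  M ^ k * (M * (M + suc k * c))             ≤⟨ *-monoʳ-≤ (M ^ k) (m≤m+n _ (k * c * c)) ⟩
  M ^ k * (M * (M + suc k * c) + k * c * c) ≡⟨ cong (M ^ k *_) (factor M c k) ⟩
  M ^ k * ((M + k * c) * (M + c))           ≡⟨ *-assoc (M ^ k) _ _ ⟨
  M ^ k * (M + k * c) * (M + c)             ≤⟨ *-monoˡ-≤ (M + c) (bernoulli M c k) ⟩
  M * (M + c) ^ k * (M + c)                 ≡⟨ regroup′ M ((M + c) ^ k) (M + c) ⟩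
  M * ((M + c) * (M + c) ^ k)               ∎
  where
  open ≤-Reasoning
  regroup : ∀ M p c k → M * p * (M + suc k * c) ≡ p * (M * (M + suc k * c))
  regroup = solve-∀
  factor : ∀ M c k → M * (M + suc k * c) + k * c * c ≡ (M + k * c) * (M + c)
  factor = solve-∀
  regroup′ : ∀ a p x → a * p * x ≡ a * (x * p)
  regroup′ = solve-∀

M+b∸⌊b/2⌋≡M+⌈b/2⌉ : ∀ M b → M + b ∸ ⌊ b /2⌋ ≡ M + ⌈ b /2⌉
M+b∸⌊b/2⌋≡M+⌈b/2⌉ M b = begin
  M + b ∸ ⌊ b /2⌋                       ≡⟨ +-∸-assoc M (⌊n/2⌋≤n b) ⟩
  M + (b ∸ ⌊ b /2⌋)                     ≡⟨ cong (λ x → M + (x ∸ ⌊ b /2⌋)) (⌊n/2⌋+⌈n/2⌉≡n b) ⟨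
  M + (⌊ b /2⌋ + ⌈ b /2⌉ ∸ ⌊ b /2⌋)     ≡⟨ cong (M +_) (m+n∸m≡n ⌊ b /2⌋ ⌈ b /2⌉) ⟩
  M + ⌈ b /2⌉                           ∎
  where open ≡-Reasoning

[1+k]*M^⌊b/2⌋≤[M+b]P′⌊b/2⌋ : ∀ k M b .{{_ : NonZero M}} → 2 * suc k * (2 * suc k) * M ≤ b * b →
                         suc k * M ^ ⌊ b /2⌋ ≤ (M + b) P′ ⌊ b /2⌋
[1+k]*M^⌊b/2⌋≤[M+b]P′⌊b/2⌋ k M b s²M≤b² = *-cancelˡ-≤ M (begin
  M * (suc k * M ^ j)          ≡⟨ rotate M k (M ^ j) ⟩
  M ^ j * (M + k * M)          ≤⟨ *-monoʳ-≤ (M ^ j) (+-monoʳ-≤ M (k*M≤⌊b/2⌋*⌈b/2⌉ k M b s²M≤b²)) ⟩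
  M ^ j * (M + j * ⌈ b /2⌉)    ≤⟨ bernoulli M ⌈ b /2⌉ j ⟩
  M * (M + ⌈ b /2⌉) ^ j        ≡⟨ cong (λ x → M * x ^ j) (M+b∸⌊b/2⌋≡M+⌈b/2⌉ M b) ⟨
  M * (M + b ∸ j) ^ j          ≤⟨ *-monoʳ-≤ M ([n∸k]^k≤P′ (M + b) j) ⟩
  M * ((M + b) P′ j)           ∎)
  where
  open ≤-Reasoning
  j : ℕ
  j = ⌊ b /2⌋
  rotate : ∀ M k p → M * (suc k * p) ≡ p * (M + k * M)
  rotate = solve-∀

ruinCount-bound-downhill : ∀ k M A b .{{_ : NonZero M}} → b ≤ A → A ≤ M + b →
                           2 * suc k * (2 * suc k) * M ≤ b * b →
                           suc k * ruinCount M A (M + b ∸ A) ≤ M ^ (M + b ∸ A)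
ruinCount-bound-downhill k M A zero    b≤A A≤M+b s²M≤b² =
  ⊥-elim (n≮0 (≤-trans (>-nonZero⁻¹ M) (≤-trans (m≤n*m M (2 * suc k * (2 * suc k))) s²M≤b²)))
ruinCount-bound-downhill k M A b@(suc _) b≤A A≤M+b s²M≤b² = *-cancelˡ-≤ (M ^ j) {{m^n≢0 M j}} (begin
  M ^ j * (suc k * R)          ≡⟨ rotate (M ^ j) (suc k) R ⟩
  R * (suc k * M ^ j)          ≤⟨ *-monoʳ-≤ R ([1+k]*M^⌊b/2⌋≤[M+b]P′⌊b/2⌋ k M b s²M≤b²) ⟩
  R * ((M + b) P′ j)           ≤⟨ *-cancelʳ-≤ _ _ (M ^ j) {{m^n≢0 M j}} stopped ⟩
  M ^ N * (N P′ j)             ≤⟨ *-monoʳ-≤ (M ^ N) (≤-trans (P′≤^ N j) (^-monoˡ-≤ j N≤M)) ⟩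
  M ^ N * M ^ j                ≡⟨ *-comm (M ^ N) (M ^ j) ⟩
  M ^ j * M ^ N                ∎)
  where
  open ≤-Reasoning
  j N R : ℕ
  j = ⌊ b /2⌋
  N = M + b ∸ A
  R = ruinCount M A N
  N≤M : N ≤ M
  N≤M = ≤-trans (∸-monoˡ-≤ A (+-monoʳ-≤ M b≤A)) (≤-reflexive (m+n∸n≡m M A))
  stopped : R * ((M + b) P′ j) * M ^ j ≤ M ^ N * (N P′ j) * M ^ j
  stopped = ruinBound (s≤s z≤n) (⌊n/2⌋≤n b) M ≤-refl A N (m+[n∸m]≡n A≤M+b)
  rotate : ∀ p k r → p * (k * r) ≡ r * (k * p)
  rotate = solve-∀

ruinCount-bound-uphill : ∀ k M A b .{{_ : NonZero M}} → A ≤ b → 2 * suc k * (2 * suc k) * M ≤ A * A →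
                         suc k * ruinCount M A (M + b ∸ A) ≤ M ^ (M + b ∸ A)
ruinCount-bound-uphill k M A b A≤b s²M≤A² = begin
  suc k * ruinCount M A (M + b ∸ A)    ≡⟨ cong (λ n → suc k * ruinCount M A n) N≡d+M ⟩
  suc k * ruinCount M A (d + M)        ≤⟨ *-monoʳ-≤ (suc k) (ruinCount-+ M A d M) ⟩
  suc k * (M ^ d * ruinCount M A M)    ≡⟨ x∙yz≈y∙xz (suc k) (M ^ d) (ruinCount M A M) ⟩
  M ^ d * (suc k * ruinCount M A M)    ≤⟨ *-monoʳ-≤ (M ^ d) level ⟩
  M ^ d * M ^ M                        ≡⟨ ^-distribˡ-+-* M d M ⟨
  M ^ (d + M)                          ≡⟨ cong (M ^_) N≡d+M ⟨
  M ^ (M + b ∸ A)                      ∎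
  where
  open ≤-Reasoning
  d : ℕ
  d = b ∸ A
  N≡d+M : M + b ∸ A ≡ d + M
  N≡d+M = trans (+-∸-assoc M A≤b) (+-comm M d)
  level : suc k * ruinCount M A M ≤ M ^ M
  level = subst (λ n → suc k * ruinCount M A n ≤ M ^ n) (m+n∸n≡m M A)
                (ruinCount-bound-downhill k M A A ≤-refl (m≤n+m A M) s²M≤A²)

corollary3 : ∀ (k : ℕ) → ∃₂ λ (M₀ s₀ : ℕ) → ∀ (M A B : ℕ) → M₀ ≤ M
             → s₀ * s₀ * M ≤ A * A → s₀ * s₀ * M ≤ B * B → A ≤ M + B
             → suc k * badCount M A (M + B ∸ A) ≤ M ^ (M + B ∸ A)
corollary3 k = 1 , 2 * suc k , bound
  where
  bound : ∀ M A B → 1 ≤ M → 2 * suc k * (2 * suc k) * M ≤ A * A → 2 * suc k * (2 * suc k) * M ≤ B * B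
        → A ≤ M + B → suc k * badCount M A (M + B ∸ A) ≤ M ^ (M + B ∸ A)
  bound M A B 1≤M s²M≤A² s²M≤B² A≤M+B rewrite badCount≡ruinCount M A (M + B ∸ A) with B ≤? A
  ... | yes B≤A = ruinCount-bound-downhill k M A B {{>-nonZero 1≤M}} B≤A A≤M+B s²M≤B²
  ... | no  B≰A = ruinCount-bound-uphill k M A B {{>-nonZero 1≤M}} (<⇒≤ (≰⇒> B≰A)) s²M≤A²
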